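{- Let $f$ be an $s$-term DNF with a fixed representation and let $K$ be a positive integer. If two terms $A,B$ of $f$ satisfy $|A|\le |B|+K$ and $|B\setminus A|\le K$, then $A$ and $B$ lie in the same cluster of $\mathrm{Clustering}(f,K)$.
   Context: Terms are conjunctions of literals, viewed as sets of literals; no term contains both $x_i$ and $\overline{x_i}$; the width $|T|$ of a term is its number of literals. Fix a total (lexicographic) order on terms. The $K$-clustering $\mathrm{Clustering}(f,K)$ is produced by the following deterministic procedure on the set $L$ of terms of $f$: while $L\neq\emptyset$, pick the first term $T$ (in the fixed order) among the terms of $L$ of minimum width, remove it from $L$, and create a cluster $C=\{T\}$ with label $T^*=T$, $S^*=\emptyset$; then, while there exists $T'\in L$ with $|\{\ell\in T': \ell\notin T^*\cup S^*\}|\le 2K$, pick the first such $T'$, remove it from $L$, add it to $C$, and update simultaneously $T^*\leftarrow T^*\cap T'$ and $S^*\leftarrow S^*\cup\{\ell,\overline{\ell}:\ell\in T^*\triangle T'\}$ (with $T^*$ the value before the update); when no such $T'$ exists, the cluster $C$ with its current label is finished. The output is the collection of clusters. -}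

module Defs where

open import Data.Nat using (ℕ; zero; suc; _<ᵇ_; _≡ᵇ_)
import Data.Nat as ℕ
open import Data.Bool using (Bool; true; false; not; _∧_; _∨_; if_then_else_; T)
import Data.Bool as 𝔹
open import Data.Product using (_×_; _,_; proj₁; proj₂)
import Data.Product.Properties as ×P
open import Data.List using (List; []; _∷_; _++_; filter; length; concatMap; [_])
import Data.List.Properties as LP
open import Data.List.Relation.Unary.Linked using (Linked)
open import Data.List.Relation.Unary.All using (All)
open import Data.List.Relation.Unary.Unique.Propositional using (Unique)
open import Data.Maybe using (Maybe; just; nothing)
open import Relation.Nullary using (¬_; ¬?)
open import Relation.Nullary.Decidable using (⌊_⌋)
open import Relation.Binary.Definitions using (DecidableEquality)
open import Data.List.Membership.Propositional using (_∈_)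

-- A literal is a variable index together with a polarity
-- (true = the positive literal x_i, false = the negated literal x̄_i).
Literal : Set
Literal = ℕ × Bool

_≟ₗ_ : DecidableEquality Literal
_≟ₗ_ = ×P.≡-dec ℕ._≟_ 𝔹._≟_

neg : Literal → Literal
neg (i , b) = (i , not b)

-- A term is represented canonically as a strictly increasing list of literals
-- (so it is a finite set of literals); its width is its length.
Term : Set
Term = List Literal

_≟ₜ_ : DecidableEquality Term
_≟ₜ_ = LP.≡-dec _≟ₗ_

open import Data.List.Membership.DecPropositional _≟ₗ_ using (_∈?_)

litLt : Literal → Literal → Bool
litLt (i , b) (j , c) = (i <ᵇ j) ∨ ((i ≡ᵇ j) ∧ (not b ∧ c))

-- lexicographic strict order on (canonical) terms: the fixed total order
lexLt : Term → Term → Bool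
lexLt []       []       = false
lexLt []       (_ ∷ _)  = true
lexLt (_ ∷ _)  []       = false
lexLt (x ∷ xs) (y ∷ ys) = litLt x y ∨ (⌊ x ≟ₗ y ⌋ ∧ lexLt xs ys)

width : Term → ℕ
width = length

WellFormedTerm : Term → Set
WellFormedTerm t = Linked (λ x y → T (litLt x y)) t × (∀ i → ¬ ((i , true) ∈ t × (i , false) ∈ t))

-- A DNF with a fixed representation: its (distinct) list of well-formed terms.
DNF : Set
DNF = List Term

WellFormedDNF : DNF → Set
WellFormedDNF f = Unique f × All WellFormedTerm f

_∩_ : Term → Term → Term
A ∩ B = filter (λ l → l ∈? B) A

_∖_ : Term → Term → Term
A ∖ B = filter (λ l → ¬? (l ∈? B)) A

_△_ : Term → Term → Term
A △ B = (A ∖ B) ++ (B ∖ A)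

withNegs : Term → Term
withNegs = concatMap (λ l → l ∷ neg l ∷ [])

pickBy : (Term → Term → Bool) → Term → List Term → Term
pickBy lt x []       = x
pickBy lt x (y ∷ ys) = pickBy lt (if lt y x then y else x) ys

pickFirst : (Term → Term → Bool) → List Term → Maybe Term
pickFirst lt []       = nothing
pickFirst lt (x ∷ xs) = just (pickBy lt x xs)

headLt : Term → Term → Bool
headLt a b = (width a <ᵇ width b) ∨ ((width a ≡ᵇ width b) ∧ lexLt a b)

remove : Term → List Term → List Term
remove t = filter (λ u → ¬? (u ≟ₜ t))

newLits : Term → Term → Term → ℕ
newLits Tstar Sstar T' = length (T' ∖ (Tstar ++ Sstar))

-- inner loop: grow cluster C with label (T*, S*) from the remaining list L;
-- returns the finished cluster and the remaining list.  Fuel ≥ length L suffices.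
grow : ℕ → (K : ℕ) → Term → Term → List Term → List Term → List Term × List Term
grow zero    K Tstar Sstar C L = C , L
grow (suc n) K Tstar Sstar C L
  with pickFirst lexLt (filter (λ T' → newLits Tstar Sstar T' ℕ.≤? 2 ℕ.* K) L)
... | nothing = C , L
... | just T' = grow n K (Tstar ∩ T') (Sstar ++ withNegs (Tstar △ T')) (C ++ [ T' ]) (remove T' L)

-- outer loop; fuel ≥ length L suffices
clusterLoop : ℕ → (K : ℕ) → List Term → List (List Term)
clusterLoop zero    K L        = []
clusterLoop (suc n) K []       = []
clusterLoop (suc n) K (x ∷ xs) =
  let Th  = pickBy headLt x xs
      L'  = remove Th (x ∷ xs)
      res = grow (length L') K Th [] [ Th ] L'
  in proj₁ res ∷ clusterLoop n K (proj₂ res)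

Clustering : DNF → ℕ → List (List Term)
Clustering f K = clusterLoop (length f) K f

{-# OPTIONS --safe #-}
-- While a cluster grows, every literal of every member lies in T* ∪ S*: a literal that
-- leaves T* when intersecting with a new member T′ lies in T* △ T′ and so enters S*.
-- Hence a remaining term Z with |Z ∖ Y| ≤ 2K for some member Y has at most 2K new
-- literals, and the cluster cannot be finished while Z remains. The hypotheses give
-- |B ∖ A| ≤ K and |A ∖ B| ≤ |B ∖ A| + |A| − |B| ≤ 2K, so whichever cluster first
-- receives A or B receives the other as well.
module Submission where

open import Defs
open import Data.Nat using (ℕ; _≤_; _+_; NonZero)
open import Data.List using (List; length)
open import Data.List.Membership.Propositional using (_∈_)
open import Data.Product using (∃; _×_)

open import Data.Bool using (true; false; T; not; _∧_)
open import Data.Bool.Properties using (T-∨; T-∧)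
open import Data.Empty using (⊥-elim)
open import Data.List using ([]; _∷_; _++_; filter; [_])
open import Data.List.Membership.Propositional.Properties
  using (∈-filter⁺; ∈-filter⁻; ∈-++⁺ˡ; ∈-++⁺ʳ; ∈-++⁻)
open import Data.List.Properties using (length-filter; filter-notAll)
import Data.List.Relation.Binary.Sublist.Propositional as Sublist
import Data.List.Relation.Binary.Sublist.Propositional.Properties as Sublist
open import Data.List.Relation.Binary.Subset.Propositional using (_⊆_)
import Data.List.Relation.Unary.All as All
import Data.List.Relation.Unary.AllPairs as AllPairs
open import Data.List.Relation.Unary.Any as Any using (here; there)
import Data.List.Relation.Unary.Linked as Linked
open import Data.List.Relation.Unary.Linked.Properties using (Linked⇒AllPairs)
open import Data.List.Relation.Unary.Unique.Propositional using (Unique; _∷_)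
import Data.List.Relation.Unary.Unique.Propositional.Properties as Unique
open import Data.Maybe using (just; nothing)
open import Data.Nat using (zero; suc; _<_; _*_; _≤?_; z≤n; s≤s)
open import Data.Nat.Properties
  using (≤-refl; ≤-trans; n≤1+n; +-mono-≤; <-trans; <-irrefl; <-≤-trans; ≤-pred; *-monoˡ-≤; <ᵇ⇒<; ≡ᵇ⇒≡;
         +-suc; +-comm; +-assoc; +-monoˡ-≤; +-monoʳ-≤; +-cancelʳ-≤; m≤m+n; <⇒≱; ≰⇒>; module ≤-Reasoning)
open import Data.Nat.Tactic.RingSolver using (solve-∀)
import Data.Product as Product
open import Data.Product using (_,_; proj₁; proj₂)
open import Data.Sum using (_⊎_; inj₁; inj₂)
import Data.Sum as Sum
open import Function.Bundles using (Equivalence)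
open import Relation.Binary.Definitions using (DecidableEquality)
open import Relation.Binary.PropositionalEquality using (_≡_; refl; sym; trans; cong)
open import Relation.Nullary using (¬_; yes; no; ¬?)
open import Relation.Unary using (Pred; Decidable)
open import Relation.Unary.Properties using (∁?)
open import Data.List.Membership.DecPropositional _≟ₗ_ using (_∈?_)

-- An order embedding of litLt into ℕ, through which litLt inherits transitivity.
rank : Literal → ℕ
rank (i , false) = i * 2
rank (i , true)  = suc (i * 2)

rank-lower : ∀ i b → i * 2 ≤ rank (i , b)
rank-lower i false = ≤-refl
rank-lower i true  = n≤1+n _

rank-upper : ∀ i b → rank (i , b) ≤ suc (i * 2)
rank-upper i false = n≤1+n _
rank-upper i true  = ≤-refl

rank-polarity : ∀ i b c → T (not b ∧ c) → rank (i , b) < rank (i , c)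
rank-polarity i false true _ = ≤-refl

litLt⇒rank< : ∀ {x y} → T (litLt x y) → rank x < rank y
litLt⇒rank< {i , b} {j , c} x<y with Equivalence.to T-∨ x<y
... | inj₁ i<j = ≤-trans (s≤s (rank-upper i b)) (≤-trans (*-monoˡ-≤ 2 (<ᵇ⇒< i j i<j)) (rank-lower j c))
... | inj₂ i=j∧b<c with Equivalence.to T-∧ i=j∧b<c
...   | i=j , b<c with refl ← ≡ᵇ⇒≡ i j i=j = rank-polarity i b c b<c

wellFormed⇒unique : ∀ {t} → WellFormedTerm t → Unique t
wellFormed⇒unique (sorted , _) =
  AllPairs.map (λ r< r≡ → <-irrefl (cong rank r≡) r<)
    (Linked⇒AllPairs <-trans (Linked.map (λ {x} {y} → litLt⇒rank< {x} {y}) sorted))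

module _ {A : Set} (_≟_ : DecidableEquality A) where

  unique-⊆⇒length≤ : ∀ {xs ys : List A} → Unique xs → xs ⊆ ys → length xs ≤ length ys
  unique-⊆⇒length≤ {[]}     _              _     = z≤n
  unique-⊆⇒length≤ {x ∷ xs} {ys} (x∉xs ∷ xs!) xs⊆ys =
    <-≤-trans (s≤s (unique-⊆⇒length≤ xs! xs⊆ys-x)) ys-x<ys
    where
    ≢x? = λ z → ¬? (z ≟ x)
    ys-x<ys : length (filter ≢x? ys) < length ys
    ys-x<ys = filter-notAll ≢x? ys (Any.map (λ x≡y x≢y → x≢y (sym x≡y)) (xs⊆ys (here refl)))
    xs⊆ys-x : xs ⊆ filter ≢x? ys
    xs⊆ys-x z∈xs = ∈-filter⁺ ≢x? (xs⊆ys (there z∈xs)) (λ z≡x → All.lookup x∉xs z∈xs (sym z≡x))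

length-filter+length-filter-∁ : ∀ {a p} {A : Set a} {P : Pred A p} (P? : Decidable P) xs →
  length (filter P? xs) + length (filter (∁? P?) xs) ≡ length xs
length-filter+length-filter-∁ P? []       = refl
length-filter+length-filter-∁ P? (x ∷ xs) with P? x
... | yes _ = cong suc (length-filter+length-filter-∁ P? xs)
... | no  _ = trans (+-suc _ _) (cong suc (length-filter+length-filter-∁ P? xs))

length-∖+length≤ : ∀ (A B : Term) → Unique B →
  length (A ∖ B) + length B ≤ length A + length (B ∖ A)
length-∖+length≤ A B B! = begin
  length (A ∖ B) + length B
    ≡⟨ cong (length (A ∖ B) +_) (sym (length-filter+length-filter-∁ (_∈? A) B)) ⟩
  length (A ∖ B) + (length (B ∩ A) + length (B ∖ A))
    ≡⟨ sym (+-assoc (length (A ∖ B)) _ _) ⟩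
  length (A ∖ B) + length (B ∩ A) + length (B ∖ A)
    ≤⟨ +-monoˡ-≤ _ (+-monoʳ-≤ (length (A ∖ B)) B∩A≤A∩B) ⟩
  length (A ∖ B) + length (A ∩ B) + length (B ∖ A)
    ≡⟨ cong (_+ length (B ∖ A)) (+-comm (length (A ∖ B)) _) ⟩
  length (A ∩ B) + length (A ∖ B) + length (B ∖ A)
    ≡⟨ cong (_+ length (B ∖ A)) (length-filter+length-filter-∁ (_∈? B) A) ⟩
  length A + length (B ∖ A)
    ∎
  where
  open ≤-Reasoning
  B∩A≤A∩B : length (B ∩ A) ≤ length (A ∩ B)
  B∩A≤A∩B = unique-⊆⇒length≤ _≟ₗ_ (Unique.filter⁺ (_∈? A) B!) λ l∈B∩A →
    let l∈B , l∈A = ∈-filter⁻ (_∈? A) {xs = B} l∈B∩A in ∈-filter⁺ (_∈? B) l∈A l∈B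

Close : ℕ → Term → Term → Set
Close K A B = length (A ∖ B) ≤ 2 * K × length (B ∖ A) ≤ 2 * K

close-of-widths : ∀ K {A B} → Unique B → length A ≤ length B + K → length (B ∖ A) ≤ K → Close K A B
close-of-widths K {A} {B} B! |A|≤|B|+K |B∖A|≤K =
  +-cancelʳ-≤ (length B) _ _ A∖B+B≤ , ≤-trans |B∖A|≤K (m≤m+n K _)
  where
  open ≤-Reasoning
  rearrange : ∀ b k → b + k + k ≡ 2 * k + b
  rearrange = solve-∀
  A∖B+B≤ : length (A ∖ B) + length B ≤ 2 * K + length B
  A∖B+B≤ = begin
    length (A ∖ B) + length B   ≤⟨ length-∖+length≤ A B B! ⟩
    length A + length (B ∖ A)   ≤⟨ +-mono-≤ |A|≤|B|+K |B∖A|≤K ⟩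
    length B + K + K            ≡⟨ rearrange (length B) K ⟩
    2 * K + length B            ∎

pickBy-∈ : ∀ lt x ys → pickBy lt x ys ∈ x ∷ ys
pickBy-∈ lt x []       = here refl
pickBy-∈ lt x (y ∷ ys) with lt y x
... | true  = there (pickBy-∈ lt y ys)
... | false with pickBy-∈ lt x ys
...   | here x≡    = here x≡
...   | there ∈ys  = there (there ∈ys)

pickFirst-∈ : ∀ {lt xs t} → pickFirst lt xs ≡ just t → t ∈ xs
pickFirst-∈ {lt} {x ∷ xs} refl = pickBy-∈ lt x xs

pickFirst≡nothing⇒∉ : ∀ {lt xs t} → pickFirst lt xs ≡ nothing → ¬ t ∈ xs
pickFirst≡nothing⇒∉ {xs = _ ∷ _} ()

∈-remove-split : ∀ {z} t {L : List Term} → z ∈ L → z ∈ [ t ] ⊎ z ∈ remove t L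
∈-remove-split {z} t z∈L with z ≟ₜ t
... | yes refl = inj₁ (here refl)
... | no  z≢t  = inj₂ (∈-filter⁺ (λ u → ¬? (u ≟ₜ t)) z∈L z≢t)

remove-length< : ∀ {t} {L : List Term} → t ∈ L → length (remove t L) < length L
remove-length< {t} {L} t∈L =
  filter-notAll (λ u → ¬? (u ≟ₜ t)) L (Any.map (λ t≡u u≢t → u≢t (sym t≡u)) t∈L)

∈-withNegs⁺ : ∀ {l D} → l ∈ D → l ∈ withNegs D
∈-withNegs⁺ (here refl) = here refl
∈-withNegs⁺ (there l∈D) = there (there (∈-withNegs⁺ l∈D))

Covers : Term → Term → List Term → Set
Covers T* S* C = ∀ {Y} → Y ∈ C → ∀ {l} → l ∈ Y → l ∈ T* ++ S*

covers-singleton : ∀ t → Covers t [] [ t ]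
covers-singleton t (here refl) l∈t = ∈-++⁺ˡ l∈t

module _ (T* S* T′ : Term) where

  private
    S*′ = S* ++ withNegs (T* △ T′)

  label⊆label-step : ∀ {l} → l ∈ T* ++ S* → l ∈ (T* ∩ T′) ++ S*′
  label⊆label-step {l} l∈ with ∈-++⁻ T* l∈
  ... | inj₂ l∈S* = ∈-++⁺ʳ (T* ∩ T′) (∈-++⁺ˡ l∈S*)
  ... | inj₁ l∈T* with l ∈? T′
  ...   | yes l∈T′ = ∈-++⁺ˡ (∈-filter⁺ (_∈? T′) l∈T* l∈T′)
  ...   | no  l∉T′ = ∈-++⁺ʳ (T* ∩ T′) (∈-++⁺ʳ S*
                       (∈-withNegs⁺ (∈-++⁺ˡ (∈-filter⁺ (∁? (_∈? T′)) l∈T* l∉T′))))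

  term⊆label-step : ∀ {l} → l ∈ T′ → l ∈ (T* ∩ T′) ++ S*′
  term⊆label-step {l} l∈T′ with l ∈? T*
  ... | yes l∈T* = ∈-++⁺ˡ (∈-filter⁺ (_∈? T′) l∈T* l∈T′)
  ... | no  l∉T* = ∈-++⁺ʳ (T* ∩ T′) (∈-++⁺ʳ S*
                     (∈-withNegs⁺ (∈-++⁺ʳ (T* ∖ T′) (∈-filter⁺ (∁? (_∈? T*)) l∈T′ l∉T*))))

  covers-step : ∀ {C} → Covers T* S* C → Covers (T* ∩ T′) S*′ (C ++ [ T′ ])
  covers-step {C} cov Y∈ l∈Y with ∈-++⁻ C Y∈
  ... | inj₁ Y∈C         = label⊆label-step (cov Y∈C l∈Y)
  ... | inj₂ (here refl) = term⊆label-step l∈Y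

newLits≤length-∖ : ∀ {T* S* C Y} → Covers T* S* C → Y ∈ C → ∀ Z → newLits T* S* Z ≤ length (Z ∖ Y)
newLits≤length-∖ {T*} {S*} {Y = Y} cov Y∈C Z = Sublist.length-mono-≤
  (Sublist.filter⁺ (∁? (_∈? (T* ++ S*))) (∁? (_∈? Y))
    (λ { refl l∉ l∈Y → l∉ (cov Y∈C l∈Y) }) (Sublist.⊆-refl {x = Z}))

module _ (K : ℕ) where

  candidate? : ∀ T* S* → Decidable (λ T′ → newLits T* S* T′ ≤ 2 * K)
  candidate? T* S* T′ = newLits T* S* T′ ≤? 2 * K

  candidates : Term → Term → List Term → List Term
  candidates T* S* = filter (candidate? T* S*)

  grow-partition : ∀ n T* S* C L {z} → z ∈ C ⊎ z ∈ L →
    z ∈ proj₁ (grow n K T* S* C L) ⊎ z ∈ proj₂ (grow n K T* S* C L)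
  grow-partition zero    T* S* C L z∈ = z∈
  grow-partition (suc n) T* S* C L z∈ with pickFirst lexLt (candidates T* S* L)
  ... | nothing = z∈
  ... | just T′ = grow-partition n _ _ (C ++ [ T′ ]) (remove T′ L) (shift z∈)
    where
    shift : ∀ {z} → z ∈ C ⊎ z ∈ L → z ∈ C ++ [ T′ ] ⊎ z ∈ remove T′ L
    shift (inj₁ z∈C) = inj₁ (∈-++⁺ˡ z∈C)
    shift (inj₂ z∈L) = Sum.map₁ (∈-++⁺ʳ C) (∈-remove-split T′ z∈L)

  grow-shrinks : ∀ n T* S* C L → length (proj₂ (grow n K T* S* C L)) ≤ length L
  grow-shrinks zero    T* S* C L = ≤-refl
  grow-shrinks (suc n) T* S* C L with pickFirst lexLt (candidates T* S* L)
  ... | nothing = ≤-refl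
  ... | just T′ = ≤-trans (grow-shrinks n _ _ (C ++ [ T′ ]) (remove T′ L))
                          (length-filter (λ u → ¬? (u ≟ₜ T′)) L)

  grow-closed : ∀ n T* S* C L → length L ≤ n → Covers T* S* C → ∀ {Y Z} →
    Y ∈ proj₁ (grow n K T* S* C L) → Z ∈ proj₂ (grow n K T* S* C L) → 2 * K < length (Z ∖ Y)
  grow-closed zero    T* S* C []      _  _   _  ()
  grow-closed zero    T* S* C (_ ∷ _) () _   _  _
  grow-closed (suc n) T* S* C L |L|≤ cov {Y} {Z} Y∈ Z∈ with pickFirst lexLt (candidates T* S* L) in picked
  ... | nothing = ≰⇒> λ Z∖Y≤ → pickFirst≡nothing⇒∉ {lexLt} picked
        (∈-filter⁺ (candidate? T* S*) Z∈ (≤-trans (newLits≤length-∖ {T*} {S*} cov Y∈ Z) Z∖Y≤))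
  ... | just T′ = grow-closed n _ _ _ _ |L′|≤ (covers-step T* S* T′ cov) Y∈ Z∈
    where
    T′∈L : T′ ∈ L
    T′∈L = proj₁ (∈-filter⁻ (candidate? T* S*) {xs = L} (pickFirst-∈ {lexLt} picked))
    |L′|≤ : length (remove T′ L) ≤ n
    |L′|≤ = ≤-pred (<-≤-trans (remove-length< T′∈L) |L|≤)

  grow-together : ∀ n T* S* C L → length L ≤ n → Covers T* S* C → ∀ {A B} → Close K A B →
    A ∈ C ⊎ A ∈ L → B ∈ C ⊎ B ∈ L →
    let (C′ , L′) = grow n K T* S* C L in (A ∈ C′ × B ∈ C′) ⊎ (A ∈ L′ × B ∈ L′)
  grow-together n T* S* C L |L|≤ cov (A∖B≤ , B∖A≤) A∈ B∈
    with grow-partition n T* S* C L A∈ | grow-partition n T* S* C L B∈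
  ... | inj₁ A∈C′ | inj₁ B∈C′ = inj₁ (A∈C′ , B∈C′)
  ... | inj₂ A∈L′ | inj₂ B∈L′ = inj₂ (A∈L′ , B∈L′)
  ... | inj₁ A∈C′ | inj₂ B∈L′ = ⊥-elim (<⇒≱ (grow-closed n T* S* C L |L|≤ cov A∈C′ B∈L′) B∖A≤)
  ... | inj₂ A∈L′ | inj₁ B∈C′ = ⊥-elim (<⇒≱ (grow-closed n T* S* C L |L|≤ cov B∈C′ A∈L′) A∖B≤)

  clusterLoop-together : ∀ n L → length L ≤ n → ∀ {A B} → Close K A B → A ∈ L → B ∈ L →
    ∃ λ C → C ∈ clusterLoop n K L × A ∈ C × B ∈ C
  clusterLoop-together zero    (_ ∷ _)  ()  _     _  _
  clusterLoop-together (suc n) (x ∷ xs) |L|≤ close A∈ B∈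
    with grow-together (length L′) H [] [ H ] L′ ≤-refl (covers-singleton H) close
           (∈-remove-split H A∈) (∈-remove-split H B∈)
       | grow-shrinks (length L′) H [] [ H ] L′
    where
    H  = pickBy headLt x xs
    L′ = remove H (x ∷ xs)
  ... | inj₁ (A∈C , B∈C) | _         = _ , here refl , A∈C , B∈C
  ... | inj₂ (A∈R , B∈R) | |R|≤|L′| =
    Product.map₂ (Product.map₁ there) (clusterLoop-together n _ |R|≤n close A∈R B∈R)
    where
    |R|≤n = ≤-trans |R|≤|L′| (≤-pred (<-≤-trans (remove-length< (pickBy-∈ headLt x xs)) |L|≤))

-- Only B needs to be free of repeated literals, and K = 0 would do as well.
lemma14 : (f : DNF) → WellFormedDNF f → (K : ℕ) → NonZero K →
    (A B : Term) → A ∈ f → B ∈ f →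
    length A ≤ length B + K → length (B ∖ A) ≤ K →
    ∃ λ C → C ∈ Clustering f K × A ∈ C × B ∈ C
lemma14 f (_ , wellFormed) K _ A B A∈f B∈f |A|≤|B|+K |B∖A|≤K =
  clusterLoop-together K (length f) f ≤-refl close A∈f B∈f
  where
  close : Close K A B
  close = close-of-widths K (wellFormed⇒unique (All.lookup wellFormed B∈f)) |A|≤|B|+K |B∖A|≤K
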